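{- For each $\varepsilon>0$, $\lim_{k\to\infty}\tau\big(k,\lceil(2+\varepsilon)k\rceil\big)=0$.
   Context: Let $\mathbf{1}$ be the all-ones vector in $\mathbb{R}^k$ and $\mathcal{Q}^*_k:=\{ -1,+1\}^k\setminus\{ -\mathbf{1},\mathbf{1}\}$. For $Y_{k,m}$ a uniformly random $m$-element subset of $\mathcal{Q}^*_k$, $\tau(k,m):=\Pr[\operatorname{conv}(Y_{k,m})\cap\operatorname{conv}\{ -\mathbf{1},\mathbf{1}\}=\varnothing]$.
   Formalization: The parameter ε ranges over the positive rationals, and the coefficients of the convex combinations in $\operatorname{conv}(Y_{k,m})$ are taken in the rationals. -}

module Defs where

open import Data.Bool using (Bool; true; false; if_then_else_)
open import Data.Nat as ℕ using (ℕ; zero; suc; _^_; _∸_)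
open import Data.Nat.Combinatorics using (_C_)
open import Data.Integer as ℤ using (+_; ∣_∣)
open import Data.Rational using (ℚ; 0ℚ; 1ℚ; -_; _+_; _*_; _≤_; _<_; ceiling; _/_)
open import Data.Fin using (Fin; zero; suc)
open import Data.Vec as Vec using (Vec)
open import Data.List as List using (List; length)
open import Data.List.Membership.Propositional using (_∈_)
open import Data.List.Relation.Unary.All using (All)
open import Data.List.Relation.Unary.AllPairs using (AllPairs)
open import Data.List.Relation.Unary.Unique.Propositional using (Unique)
open import Data.Product using (Σ; _×_; ∃)
open import Relation.Binary.PropositionalEquality using (_≡_; _≢_)
open import Relation.Nullary using (¬_)

-- A point of {-1,+1}^k, encoded as a Bool vector (true = +1, false = -1).
Cube : ℕ → Set
Cube k = Vec Bool k

sign : Bool → ℚ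
sign true  = 1ℚ
sign false = - 1ℚ

InQ* : ∀ {k} → Cube k → Set
InQ* {k} x = (x ≢ Vec.replicate k true) × (x ≢ Vec.replicate k false)

sumFin : (n : ℕ) → (Fin n → ℚ) → ℚ
sumFin zero    f = 0ℚ
sumFin (suc n) f = f zero + sumFin n (λ i → f (suc i))

-- conv(Y) ∩ conv{-1,1} ≠ ∅ : some convex combination of the points of Y
-- equals t·1 for some t ∈ [-1,1].
MeetsDiagonal : ∀ {k} → List (Cube k) → Set
MeetsDiagonal {k} Y =
  Σ (Fin (length Y) → ℚ) λ w → Σ ℚ λ t →
    (∀ i → 0ℚ ≤ w i) × (sumFin (length Y) w ≡ 1ℚ) ×
    (- 1ℚ ≤ t) × (t ≤ 1ℚ) ×
    (∀ (j : Fin k) →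
       sumFin (length Y) (λ i → w i * sign (Vec.lookup (List.lookup Y i) j)) ≡ t)

IsSubsetQ* : (k m : ℕ) → List (Cube k) → Set
IsSubsetQ* k m Y = Unique Y × All InQ* Y × (length Y ≡ m)

SameSet : ∀ {k} → List (Cube k) → List (Cube k) → Set
SameSet Y Z = ∀ x → (x ∈ Y → x ∈ Z) × (x ∈ Z → x ∈ Y)

-- A list of pairwise distinct m-subsets Y of Q*_k with conv Y ∩ conv{-1,1} = ∅.
-- τ(k,m) = (max length of such a list) / C(2^k - 2, m).
DisjointFamily : (k m : ℕ) → List (List (Cube k)) → Set
DisjointFamily k m L =
  All (λ Y → IsSubsetQ* k m Y × ¬ MeetsDiagonal Y) L ×
  AllPairs (λ Y Z → ¬ SameSet Y Z) L

mOf : ℚ → ℕ → ℕ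
mOf ε k = ∣ ceiling (((+ 2) / 1 + ε) * ((+ k) / 1)) ∣

N : ℕ → ℕ
N k = 2 ^ k ∸ 2

{-# OPTIONS --safe #-}
module Submission where

-- A set Y of the family misses the segment conv{-1, 1} ∋ 0, so 0 ∉ conv Y; in particular Y
-- has no antipodal pair and is a signed choice of m of the n = 2^(k-1) - 1 antipodal pairs
-- of Q*_k. Cover's argument (split on one point; the sign patterns that work with both signs
-- of it survive the projection along it) shows that at most C(n,m) · cover m k signed choices
-- of m points of ℚ^k avoid 0 in their convex hull. Since C(n,m) · 2^m ≤ C(2n,m), τ is at most
-- cover m k / 2^m, and Chernoff's bound for Cover's function makes this tend to 0 once
-- m ≥ (2 + 1/P) k.

module ListFacts where
  open import Data.Nat using (suc; _+_; _≤_; z≤n; s≤s)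
  open import Data.Nat.Properties using (+-suc; module ≤-Reasoning)
  open import Data.Vec as Vec using ()
  import Data.Vec.Relation.Unary.All.Properties as VecAllₚ
  import Data.Vec.Relation.Unary.Unique.Propositional as VecUnique
  open import Data.Vec.Relation.Unary.AllPairs using ([]; _∷_)
  open import Data.List using (List; []; _∷_; length; filter)
  open import Data.List.Properties using (length-removeAt′)
  open import Data.List.Membership.Propositional using (_∈_; _─_)
  open import Data.List.Relation.Binary.Subset.Propositional using (_⊆_)
  open import Data.List.Relation.Unary.Any as Any using (here; there)
  open import Data.List.Relation.Unary.All as All using (All; []; _∷_)
  open import Data.List.Relation.Unary.Unique.Propositional using (Unique; []; _∷_)
  open import Data.Empty using (⊥-elim)
  open import Relation.Binary.PropositionalEquality
  open import Relation.Nullary using (¬_; yes; no)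
  open import Relation.Unary using (Decidable)
  open import Relation.Unary.Properties using (∁?)

  length-filter-∁ : ∀ {A : Set} {P : A → Set} (P? : Decidable P) (xs : List A) →
                    length (filter (∁? P?) xs) + length (filter P? xs) ≡ length xs
  length-filter-∁ P? []       = refl
  length-filter-∁ P? (x ∷ xs) with P? x
  ... | yes _ = trans (+-suc _ _) (cong suc (length-filter-∁ P? xs))
  ... | no _  = cong suc (length-filter-∁ P? xs)

  length-All-absurd : ∀ {A : Set} {Q : A → Set} {xs : List A} →
                      (∀ x → ¬ Q x) → All Q xs → length xs ≡ 0
  length-All-absurd ¬Q []       = refl
  length-All-absurd ¬Q (q ∷ qs) = ⊥-elim (¬Q _ q)

  ∈-─⁺ : ∀ {A : Set} {x z : A} {ys} (x∈ys : x ∈ ys) → z ∈ ys → x ≢ z → z ∈ ys ─ x∈ys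
  ∈-─⁺ (here refl) (here refl) x≢z = ⊥-elim (x≢z refl)
  ∈-─⁺ (here _)    (there z∈)  _   = z∈
  ∈-─⁺ (there _)   (here refl) _   = here refl
  ∈-─⁺ (there x∈)  (there z∈)  x≢z = there (∈-─⁺ x∈ z∈ x≢z)

  Unique-⊆⇒length≤ : ∀ {A : Set} {xs ys : List A} → Unique xs → xs ⊆ ys → length xs ≤ length ys
  Unique-⊆⇒length≤ {xs = []}     _          _     = z≤n
  Unique-⊆⇒length≤ {xs = x ∷ xs} {ys} (x∉xs ∷ u) xs⊆ys = begin
    suc (length xs)           ≤⟨ s≤s (Unique-⊆⇒length≤ u λ z∈xs →
                                   ∈-─⁺ x∈ys (xs⊆ys (there z∈xs)) (All.lookup x∉xs z∈xs)) ⟩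
    suc (length (ys ─ x∈ys))  ≡⟨ sym (length-removeAt′ ys (Any.index x∈ys)) ⟩
    length ys                 ∎
    where
    open ≤-Reasoning
    x∈ys = xs⊆ys (here refl)

  Unique-fromList : ∀ {A : Set} {xs : List A} → Unique xs → VecUnique.Unique (Vec.fromList xs)
  Unique-fromList []          = []
  Unique-fromList (x∉xs ∷ u) = VecAllₚ.fromList⁺ x∉xs ∷ Unique-fromList u

module Hull where
  open import Data.Nat using (ℕ; suc)
  open import Data.Fin using (Fin; punchIn; punchOut)
  open import Data.Fin.Properties using (punchIn-punchOut) renaming (_≟_ to _≟ᶠ_)
  open import Data.Rational
    using (ℚ; 0ℚ; 1ℚ; _+_; _*_; -_; _-_; _≤_; _<_; _≤?_; 1/_; NonZero; ≢-nonZero)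
  open import Data.Rational.Properties
  open import Data.Rational.Solver using (module +-*-Solver)
  open import Data.List using (List; []; _∷_)
  open import Data.List.Relation.Unary.Any using (Any; here; there)
  open import Data.List.Relation.Unary.All as All using (All; []; _∷_)
  open import Data.Product using (Σ-syntax; _×_; _,_; proj₁; proj₂)
  open import Data.Sum using (_⊎_; inj₁; inj₂)
  open import Relation.Binary.PropositionalEquality
  open import Relation.Nullary using (yes; no)
  open +-*-Solver

  Point : ℕ → Set
  Point d = Fin d → ℚ

  _∈≗_ : ∀ {d} → Point d → List (Point d) → Set
  v ∈≗ X = Any (v ≗_) X

  _⊆≗_ : ∀ {d} → List (Point d) → List (Point d) → Set
  X ⊆≗ Y = ∀ {v} → v ∈≗ X → v ∈≗ Y

  negate : ∀ {d} → Point d → Point d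
  negate x i = - x i

  Combination : ℕ → Set
  Combination d = List (ℚ × Point d)

  totalWeight : ∀ {d} → Combination d → ℚ
  totalWeight []            = 0ℚ
  totalWeight ((l , _) ∷ W) = l + totalWeight W

  combine : ∀ {d} → Combination d → Point d
  combine []            i = 0ℚ
  combine ((l , v) ∷ W) i = l * v i + combine W i

  ConicOver : ∀ {d} → List (Point d) → Combination d → Set
  ConicOver X = All (λ t → 0ℚ ≤ proj₁ t × proj₂ t ∈≗ X)

  ConicOver-mono : ∀ {d} {X Y : List (Point d)} {W} → X ⊆≗ Y → ConicOver X W → ConicOver Y W
  ConicOver-mono X⊆Y = All.map (λ (l≥0 , v∈X) → l≥0 , X⊆Y v∈X)

  -- Dividing by the positive total weight turns W into a convex combination.
  0∈Conv : ∀ {d} → List (Point d) → Set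
  0∈Conv {d} X = Σ[ W ∈ Combination d ]
    ConicOver X W × 0ℚ < totalWeight W × (∀ i → combine W i ≡ 0ℚ)

  0∈Conv-mono : ∀ {d} {X Y : List (Point d)} → X ⊆≗ Y → 0∈Conv X → 0∈Conv Y
  0∈Conv-mono X⊆Y (W , conic , pos , W≗0) = W , ConicOver-mono X⊆Y conic , pos , W≗0

  0∈Conv-zero : ∀ {d} {x : Point d} (X : List (Point d)) →
                (∀ i → x i ≡ 0ℚ) → 0∈Conv (x ∷ X)
  0∈Conv-zero {x = x} X x≗0 =
    (1ℚ , x) ∷ [] , (<⇒≤ 0<1 , here (λ _ → refl)) ∷ [] , 0<1 ,
    λ i → trans (+-identityʳ _) (trans (*-identityˡ (x i)) (x≗0 i))
    where
    0<1 : 0ℚ < 1ℚ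
    0<1 = positive⁻¹ 1ℚ

  -- Add |a| times -z or z, according to the sign of a.
  0∈Conv-parallel : ∀ {d} {X : List (Point d)} {W : Combination d} (z : Point d) (a : ℚ) →
    ConicOver X W → 0ℚ < totalWeight W → (∀ i → combine W i ≡ a * z i) →
    0∈Conv (z ∷ X) ⊎ 0∈Conv (negate z ∷ X)
  0∈Conv-parallel {W = W} z a conic pos W≗az with 0ℚ ≤? a
  ... | yes a≥0 = inj₂ ((a , negate z) ∷ W , (a≥0 , here (λ _ → refl)) ∷ ConicOver-mono there conic ,
        +-mono-≤-< a≥0 pos ,
        λ i → trans (cong (a * - z i +_) (W≗az i))
                    (solve 2 (λ a x → a :* (:- x) :+ a :* x := con 0ℚ) refl a (z i)))
  ... | no a≱0 = inj₁ ((- a , z) ∷ W , (-a≥0 , here (λ _ → refl)) ∷ ConicOver-mono there conic ,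
        +-mono-≤-< -a≥0 pos ,
        λ i → trans (cong (- a * z i +_) (W≗az i))
                    (solve 2 (λ a x → (:- a) :* x :+ a :* x := con 0ℚ) refl a (z i)))
    where
    -a≥0 : 0ℚ ≤ - a
    -a≥0 = neg-antimono-≤ (<⇒≤ (≰⇒> a≱0))

  -- π y is y - (y_j / z_j) z with its coordinate j (now 0) dropped: a linear map with kernel ℚz.
  module Projection {d : ℕ} (z : Point (suc d)) (j : Fin (suc d)) (zj≢0 : z j ≢ 0ℚ) where

    instance
      zj-nonZero : NonZero (z j)
      zj-nonZero = ≢-nonZero zj≢0

    coeff : Point (suc d) → ℚ
    coeff y = y j * 1/ z j

    π : Point (suc d) → Point d
    π y i = y (punchIn j i) - coeff y * z (punchIn j i)

    π-negate : ∀ y → π (negate y) ≗ negate (π y)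
    π-negate y i =
      solve 4 (λ a b c e → (:- a) :- ((:- b) :* c) :* e := :- (a :- (b :* c) :* e)) refl
        (y (punchIn j i)) (y j) (1/ z j) (z (punchIn j i))

    π≗0⇒parallel : ∀ y → (∀ i → π y i ≡ 0ℚ) → ∀ b → y b ≡ coeff y * z b
    π≗0⇒parallel y πy≗0 b with b ≟ᶠ j
    ... | yes refl = sym (trans (*-assoc (y j) (1/ z j) (z j))
                       (trans (cong (y j *_) (*-inverseˡ (z j))) (*-identityʳ (y j))))
    ... | no b≢j = subst (λ c → y c ≡ coeff y * z c) (punchIn-punchOut j≢b)
                     (x-y≡0⇒x≡y (πy≗0 (punchOut j≢b)))
      where
      j≢b = λ j≡b → b≢j (sym j≡b)
      x-y≡0⇒x≡y : ∀ {x y} → x - y ≡ 0ℚ → x ≡ y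
      x-y≡0⇒x≡y {x} {y} x-y≡0 =
        trans (solve 2 (λ x y → x := (x :- y) :+ y) refl x y)
              (trans (cong (_+ y) x-y≡0) (+-identityˡ y))

    _⊆π_ : List (Point d) → List (Point (suc d)) → Set
    X′ ⊆π X = ∀ {v} → v ∈≗ X′ → Σ[ u ∈ Point (suc d) ] u ∈≗ X × v ≗ π u

    lift : ∀ {X′ X} → X′ ⊆π X → (W : Combination d) → ConicOver X′ W →
      Σ[ W′ ∈ Combination (suc d) ] ConicOver X W′ × totalWeight W′ ≡ totalWeight W ×
        (∀ i → combine W i ≡ π (combine W′) i)
    lift X′⊆πX [] [] = [] , [] , refl ,
      λ i → solve 2 (λ c x → con 0ℚ := con 0ℚ :- (con 0ℚ :* c) :* x) refl (1/ z j) (z (punchIn j i))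
    lift X′⊆πX ((l , v) ∷ W) ((l≥0 , v∈X′) ∷ conic)
      with u , u∈X , v≗πu ← X′⊆πX v∈X′
         | W′ , conic′ , same-weight , W≗πW′ ← lift X′⊆πX W conic =
      (l , u) ∷ W′ , (l≥0 , u∈X) ∷ conic′ , cong (l +_) same-weight ,
      λ i → trans (cong₂ (λ p q → l * p + q) (v≗πu i) (W≗πW′ i))
        (solve 7 (λ l ui uj r zi Si Sj →
             l :* (ui :- (uj :* r) :* zi) :+ (Si :- (Sj :* r) :* zi)
             := (l :* ui :+ Si) :- ((l :* uj :+ Sj) :* r) :* zi) refl
           l (u (punchIn j i)) (u j) (1/ z j) (z (punchIn j i))
           (combine W′ (punchIn j i)) (combine W′ j))

    0∈Conv-project : ∀ {X′ X} → X′ ⊆π X → 0∈Conv X′ → 0∈Conv (z ∷ X) ⊎ 0∈Conv (negate z ∷ X)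
    0∈Conv-project X′⊆πX (W , conic , pos , W≗0)
      with W′ , conic′ , same-weight , W≗πW′ ← lift X′⊆πX W conic =
      0∈Conv-parallel z (coeff (combine W′)) conic′ (subst (0ℚ <_) (sym same-weight) pos)
        (π≗0⇒parallel (combine W′) (λ i → trans (sym (W≗πW′ i)) (W≗0 i)))

module SignedSelection where
  open Hull
  open import Data.Nat using (ℕ; suc)
  open import Data.Maybe using (Maybe; nothing; just)
  open import Data.Sign as Sign using (Sign)
  open import Data.Vec as Vec using (Vec; []; _∷_)
  open import Data.Vec.Relation.Unary.All as VecAll using ([]; _∷_)
  import Data.Vec.Relation.Unary.Unique.Propositional as VecUnique
  open import Data.Vec.Relation.Unary.AllPairs using ([]; _∷_)
  open import Data.List using (List; []; _∷_; length)
  open import Data.List.Membership.Propositional using (_∈_)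
  open import Data.List.Relation.Binary.Subset.Propositional using (_⊆_)
  open import Data.Vec.Relation.Unary.Any as VecAny using (here; there)
  open import Data.List.Relation.Unary.Any using (here; there)
  open import Data.List.Relation.Unary.All using (All; []; _∷_)
  open import Data.List.Relation.Unary.Unique.Propositional using (Unique; []; _∷_)
  open import Data.Product using (Σ-syntax; _×_; _,_)
  open import Function.Definitions using (Injective)
  open import Relation.Binary.PropositionalEquality

  -- nothing: the point is not selected; just s: it is selected with sign s.
  Pattern : ℕ → Set
  Pattern = Vec (Maybe Sign)

  signed : ∀ {A : Set} → (A → A) → Sign → A → A
  signed neg Sign.+ x = x
  signed neg Sign.- x = neg x

  select : ∀ {A : Set} {n} → (A → A) → Pattern n → Vec A n → List A
  select neg []            []       = []
  select neg (nothing ∷ c) (x ∷ xs) = select neg c xs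
  select neg (just s ∷ c)  (x ∷ xs) = signed neg s x ∷ select neg c xs

  weight : ∀ {n} → Pattern n → ℕ
  weight []            = 0
  weight (nothing ∷ c) = weight c
  weight (just _ ∷ c)  = suc (weight c)

  length-select : ∀ {A : Set} {n} (neg : A → A) (c : Pattern n) (xs : Vec A n) →
                  length (select neg c xs) ≡ weight c
  length-select neg []            []       = refl
  length-select neg (nothing ∷ c) (x ∷ xs) = length-select neg c xs
  length-select neg (just s ∷ c)  (x ∷ xs) = cong suc (length-select neg c xs)

  select-map : ∀ {A : Set} {d n} {neg : A → A} (f : A → Point d) →
    (∀ x → f (neg x) ≗ negate (f x)) → (c : Pattern n) (xs : Vec A n) →
    ∀ {v} → v ∈≗ select negate c (Vec.map f xs) → Σ[ u ∈ A ] u ∈ select neg c xs × v ≗ f u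
  select-map f f-neg []            []       ()
  select-map f f-neg (nothing ∷ c) (x ∷ xs) v∈ = select-map f f-neg c xs v∈
  select-map f f-neg (just s ∷ c) (x ∷ xs) (there v∈)
    with u , u∈ , v≗fu ← select-map f f-neg c xs v∈ = u , there u∈ , v≗fu
  select-map f f-neg (just Sign.+ ∷ c) (x ∷ xs) (here v≗fx) = x , here refl , v≗fx
  select-map f f-neg (just Sign.- ∷ c) (x ∷ xs) (here v≗-fx) =
    _ , here refl , λ i → trans (v≗-fx i) (sym (f-neg x i))

  All-select : ∀ {A : Set} {n} {neg : A → A} {Q : A → Set} (c : Pattern n) {xs : Vec A n} →
               VecAll.All (λ x → Q x × Q (neg x)) xs → All Q (select neg c xs)
  All-select []                {[]}     []             = []
  All-select (nothing ∷ c)     {x ∷ xs} (_ ∷ qs)       = All-select c qs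
  All-select (just Sign.+ ∷ c) {x ∷ xs} ((q , _) ∷ qs) = q ∷ All-select c qs
  All-select (just Sign.- ∷ c) {x ∷ xs} ((_ , q) ∷ qs) = q ∷ All-select c qs

  -- Pos singles out at most one point of each pair {x, neg x}.
  Unique-select : ∀ {A : Set} {n} {neg : A → A} {Pos : A → Set} →
    Injective _≡_ _≡_ neg → (∀ {x y} → Pos x → Pos y → neg x ≢ y) →
    (c : Pattern n) {xs : Vec A n} → VecAll.All Pos xs → VecUnique.Unique xs → Unique (select neg c xs)
  Unique-select inj anti []           {[]}     []        []        = []
  Unique-select inj anti (nothing ∷ c) {x ∷ xs} (_ ∷ ps)  (_ ∷ u)   = Unique-select inj anti c ps u
  Unique-select {neg = neg} {Pos} inj anti (just s ∷ c) {x ∷ xs} (px ∷ ps) (x∉ ∷ u) =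
    All-select c (VecAll.map (λ (x≢y , py) → distinct s x≢y py) (VecAll.zip (x∉ , ps)))
    ∷ Unique-select inj anti c ps u
    where
    distinct : ∀ s {y} → x ≢ y → Pos y → signed neg s x ≢ y × signed neg s x ≢ neg y
    distinct Sign.+ x≢y py = x≢y , λ x≡-y → anti py px (sym x≡-y)
    distinct Sign.- x≢y py = anti px py , λ -x≡-y → x≢y (inj -x≡-y)

  module _ {A : Set} {neg : A → A} (f : A → Maybe Sign) where

    select-⊆ : ∀ {Y : List A} → (∀ {x s} → f x ≡ just s → signed neg s x ∈ Y) →
               ∀ {n} (xs : Vec A n) → select neg (Vec.map f xs) xs ⊆ Y
    select-⊆ sound (x ∷ xs) y∈ with f x in fx≡
    ... | nothing = select-⊆ sound xs y∈
    select-⊆ sound (x ∷ xs) (here refl)  | just s = sound fx≡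
    select-⊆ sound (x ∷ xs) (there y∈)   | just s = select-⊆ sound xs y∈

    ∈-select : ∀ {n y} (xs : Vec A n) →
      VecAny.Any (λ x → Σ[ s ∈ Sign ] f x ≡ just s × signed neg s x ≡ y) xs →
      y ∈ select neg (Vec.map f xs) xs
    ∈-select (x ∷ xs) (here (s , fx≡ , refl)) rewrite fx≡ = here refl
    ∈-select (x ∷ xs) (there any) with f x
    ... | nothing = ∈-select xs any
    ... | just _  = there (∈-select xs any)

module CoverCount where
  open ListFacts
  open Hull
  open SignedSelection
  open import Data.Nat using (ℕ; zero; suc; _+_; _*_; _≤_; z≤n)
  open import Data.Nat.Properties
    using (≤-refl; ≤-reflexive; +-mono-≤; +-comm; +-assoc; +-suc; +-identityʳ; suc-injective;
           *-distribˡ-+; *-distribʳ-+; module ≤-Reasoning)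
  open import Data.Nat.Combinatorics using (_C_; nCk+nC[k+1]≡[n+1]C[k+1])
  open import Data.Fin using (Fin)
  open import Data.Fin.Properties using (all?; ¬∀⟶∃¬)
  open import Data.Maybe using (Maybe; nothing; just)
  open import Data.Maybe.Properties using (≡-dec)
  open import Data.Sign as Sign using (Sign)
  open import Data.Sign.Properties using () renaming (_≟_ to _≟ˢ_)
  open import Data.Rational using (0ℚ; -_)
  open import Data.Rational.Properties using () renaming (_≟_ to _≟ℚ_)
  open import Data.Vec as Vec using (Vec; []; _∷_)
  import Data.Vec.Properties as Vecₚ
  open import Data.List using (List; []; _∷_; length; _++_; filter)
  open import Data.List.Properties using (length-++)
  open import Data.List.Membership.Propositional using (_∈_)
  open import Data.List.Membership.Propositional.Properties using (∈-filter⁻)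
  import Data.List.Membership.DecPropositional as DecMembership
  open import Data.List.Relation.Unary.Any as Any using (there)
  open import Data.List.Relation.Unary.All as All using (All; []; _∷_)
  import Data.List.Relation.Unary.All.Properties as Allₚ
  open import Data.List.Relation.Unary.Unique.Propositional using (Unique; []; _∷_)
  import Data.List.Relation.Unary.Unique.Propositional.Properties as Uniqueₚ
  open import Data.Product using (_,_; proj₂)
  open import Data.Sum using ([_,_])
  open import Data.Empty using (⊥-elim)
  open import Function using (_∘_)
  open import Relation.Binary.PropositionalEquality hiding ([_])
  open import Relation.Nullary using (¬_; yes; no)
  open import Relation.Unary.Properties using (∁?)

  -- Cover's function: for m ≥ 1 it is 2 Σ_{i<d} C(m-1, i), the number of sign
  -- vectors s for which 0 ∉ conv {s_i x_i} when x_1, …, x_m ∈ ℚ^d are in general position.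
  cover : ℕ → ℕ → ℕ
  cover zero    d       = 1
  cover (suc m) zero    = 0
  cover (suc m) (suc d) = cover m (suc d) + cover m d

  record Feasible {d n} (m : ℕ) (P : Vec (Point d) n) (c : Pattern n) : Set where
    constructor feasible
    field
      weight≡ : weight c ≡ m
      0∉Conv  : ¬ 0∈Conv (select negate c P)

  withHead : ∀ {n} → Maybe Sign → List (Pattern (suc n)) → List (Pattern n)
  withHead h []              = []
  withHead h ((h′ ∷ c) ∷ F) with ≡-dec _≟ˢ_ h h′
  ... | yes _ = c ∷ withHead h F
  ... | no _  = withHead h F

  length-withHead : ∀ {n} (F : List (Pattern (suc n))) →
    length F ≡ length (withHead nothing F) +
               (length (withHead (just Sign.+) F) + length (withHead (just Sign.-) F))
  length-withHead []                      = refl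
  length-withHead ((nothing ∷ c) ∷ F)     = cong suc (length-withHead F)
  length-withHead ((just Sign.+ ∷ c) ∷ F) = trans (cong suc (length-withHead F)) (sym (+-suc _ _))
  length-withHead ((just Sign.- ∷ c) ∷ F) = trans (cong suc (length-withHead F))
    (sym (trans (cong (length (withHead nothing F) +_) (+-suc _ _)) (+-suc _ _)))

  withHead⁺ : ∀ {n} {Q : Pattern (suc n) → Set} h {F} → All Q F → All (λ c → Q (h ∷ c)) (withHead h F)
  withHead⁺ h {[]}           []       = []
  withHead⁺ h {(h′ ∷ c) ∷ F} (q ∷ qs) with ≡-dec _≟ˢ_ h h′
  ... | yes refl = q ∷ withHead⁺ h qs
  ... | no _     = withHead⁺ h qs

  Unique-withHead : ∀ {n} h {F : List (Pattern (suc n))} → Unique F → Unique (withHead h F)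
  Unique-withHead h {[]}           []        = []
  Unique-withHead h {(h′ ∷ c) ∷ F} (c∉F ∷ u) with ≡-dec _≟ˢ_ h h′
  ... | yes refl = All.map (λ ≢ ≡ → ≢ (cong (h ∷_) ≡)) (withHead⁺ h c∉F) ∷ Unique-withHead h u
  ... | no _     = Unique-withHead h u

  CountBound : ℕ → ℕ → Set
  CountBound n m = ∀ {d} (P : Vec (Point d) n) (F : List (Pattern n)) →
    Unique F → All (Feasible m P) F → length F ≤ (n C m) * cover m d

  module _ {n m : ℕ} (count : CountBound n m) where

    Signed : ∀ {d} → Sign → Point d → Vec (Point d) n → Pattern n → Set
    Signed s x P c = Feasible (suc m) (x ∷ P) (just s ∷ c)

    drop-signed : ∀ {d s} {x : Point d} {P c} → Signed s x P c → Feasible m P c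
    drop-signed (feasible weight≡ ∌0) = feasible (suc-injective weight≡) (∌0 ∘ 0∈Conv-mono there)

    -- |F₊| + |F₋| = |F₊ ∪ F₋| + |F₊ ∩ F₋|; the union is feasible without x, and patterns
    -- feasible with both signs of x stay feasible after projecting along x.
    union-intersection : ∀ {d} (x : Point (suc d)) (j : Fin (suc d)) (xj≢0 : x j ≢ 0ℚ) P F₊ F₋ →
      Unique F₊ → Unique F₋ → All (Signed Sign.+ x P) F₊ → All (Signed Sign.- x P) F₋ →
      length F₊ + length F₋ ≤ (n C m) * cover (suc m) (suc d)
    union-intersection {d} x j xj≢0 P F₊ F₋ u₊ u₋ f₊ f₋ = begin
      length F₊ + length F₋
        ≡⟨ cong (length F₊ +_) (sym (length-filter-∁ (_∈? F₊) F₋)) ⟩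
      length F₊ + (length F₋∖F₊ + length F₋∩F₊)
        ≡⟨ sym (+-assoc (length F₊) _ _) ⟩
      length F₊ + length F₋∖F₊ + length F₋∩F₊
        ≡⟨ cong (_+ length F₋∩F₊) (sym (length-++ F₊)) ⟩
      length (F₊ ++ F₋∖F₊) + length F₋∩F₊
        ≤⟨ +-mono-≤ (count P (F₊ ++ F₋∖F₊) unique-∪ feasible-∪)
                    (count (Vec.map π P) F₋∩F₊ unique-∩ feasible-∩) ⟩
      (n C m) * cover m (suc d) + (n C m) * cover m d
        ≡⟨ sym (*-distribˡ-+ (n C m) _ _) ⟩
      (n C m) * cover (suc m) (suc d) ∎
      where
      open ≤-Reasoning
      open Projection x j xj≢0
      open DecMembership (Vecₚ.≡-dec (≡-dec _≟ˢ_)) using (_∈?_)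
      F₋∩F₊ = filter (_∈? F₊) F₋
      ∉F₊? = ∁? (_∈? F₊)
      F₋∖F₊ = filter ∉F₊? F₋
      unique-∪ : Unique (F₊ ++ F₋∖F₊)
      unique-∪ = Uniqueₚ.++⁺ u₊ (Uniqueₚ.filter⁺ ∉F₊? u₋)
                   λ (c∈F₊ , c∈F₋∖F₊) → proj₂ (∈-filter⁻ ∉F₊? {xs = F₋} c∈F₋∖F₊) c∈F₊
      feasible-∪ : All (Feasible m P) (F₊ ++ F₋∖F₊)
      feasible-∪ = Allₚ.++⁺ (All.map drop-signed f₊) (Allₚ.filter⁺ ∉F₊? (All.map drop-signed f₋))
      unique-∩ : Unique F₋∩F₊
      unique-∩ = Uniqueₚ.filter⁺ (_∈? F₊) u₋
      projected : ∀ c → select negate c (Vec.map π P) ⊆π select negate c P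
      projected c v∈ with u , u∈ , v≗πu ← select-map π π-negate c P v∈ =
        u , Any.map (λ { refl _ → refl }) u∈ , v≗πu
      feasible-both : ∀ {c} → c ∈ F₊ → Signed Sign.- x P c → Feasible m (Vec.map π P) c
      feasible-both {c} c∈F₊ (feasible weight≡ ∌0₋) = feasible (suc-injective weight≡) λ 0∈ →
        [ Feasible.0∉Conv (All.lookup f₊ c∈F₊) , ∌0₋ ] (0∈Conv-project (projected c) 0∈)
      feasible-∩ : All (Feasible m (Vec.map π P)) F₋∩F₊
      feasible-∩ = All.zipWith (λ (c∈F₊ , f) → feasible-both c∈F₊ f)
                     (Allₚ.all-filter (_∈? F₊) F₋ , Allₚ.filter⁺ (_∈? F₊) f₋)

    signed-zero : ∀ {d} {x : Point d} {P F₊ F₋ b} → (∀ i → x i ≡ 0ℚ) →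
      All (Signed Sign.+ x P) F₊ → All (Signed Sign.- x P) F₋ → length F₊ + length F₋ ≤ b
    signed-zero {b = b} x≗0 f₊ f₋ = subst (_≤ b) (sym (cong₂ _+_
      (length-All-absurd (λ _ (feasible _ ∌0) → ∌0 (0∈Conv-zero _ x≗0)) f₊)
      (length-All-absurd (λ _ (feasible _ ∌0) → ∌0 (0∈Conv-zero _ (λ i → cong -_ (x≗0 i)))) f₋))) z≤n

    signed-count : ∀ {d} (x : Point d) P F₊ F₋ →
      Unique F₊ → Unique F₋ → All (Signed Sign.+ x P) F₊ → All (Signed Sign.- x P) F₋ →
      length F₊ + length F₋ ≤ (n C m) * cover (suc m) d
    signed-count {zero} x P F₊ F₋ u₊ u₋ f₊ f₋ = signed-zero (λ ()) f₊ f₋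
    signed-count {suc d} x P F₊ F₋ u₊ u₋ f₊ f₋ with all? (λ i → x i ≟ℚ 0ℚ)
    ... | yes x≗0 = signed-zero x≗0 f₊ f₋
    ... | no x≢0 with j , xj≢0 ← ¬∀⟶∃¬ (suc d) _ (λ i → x i ≟ℚ 0ℚ) x≢0 =
      union-intersection x j xj≢0 P F₊ F₋ u₊ u₋ f₊ f₋

  count-feasible : ∀ n m → CountBound n m
  count-feasible zero m       []       []            _                 _                       = z≤n
  count-feasible zero .zero   []       ([] ∷ [])     _                 (feasible refl _ ∷ [])  = ≤-refl
  count-feasible zero m       []       ([] ∷ [] ∷ F) ((≢[] ∷ _) ∷ _)   _                       = ⊥-elim (≢[] refl)
  count-feasible (suc n) m {d} (x ∷ P) F u f = begin
    length F                                ≡⟨ length-withHead F ⟩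
    length F₀ + (length F₊ + length F₋)     ≤⟨ +-mono-≤ (count-feasible n m P F₀ (Unique-withHead nothing u) f₀)
                                                         (count-signed m f) ⟩
    (n C m) * cover m d + signedBound m     ≡⟨ pascal m ⟩
    (suc n C m) * cover m d                 ∎
    where
    open ≤-Reasoning
    F₀ = withHead nothing F
    F₊ = withHead (just Sign.+) F
    F₋ = withHead (just Sign.-) F
    f₀ : All (Feasible m P) F₀
    f₀ = All.map (λ (feasible weight≡ ∌0) → feasible weight≡ ∌0) (withHead⁺ nothing f)
    signedBound : ℕ → ℕ
    signedBound zero    = 0
    signedBound (suc m) = (n C m) * cover (suc m) d
    count-signed : ∀ m → All (Feasible m (x ∷ P)) F → length F₊ + length F₋ ≤ signedBound m
    count-signed zero    f = ≤-reflexive (cong₂ _+_ (length-All-absurd (λ { _ (feasible () _) }) (withHead⁺ _ f))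
                                                    (length-All-absurd (λ { _ (feasible () _) }) (withHead⁺ _ f)))
    count-signed (suc m) f = signed-count (count-feasible n m) x P F₊ F₋
      (Unique-withHead _ u) (Unique-withHead _ u) (withHead⁺ _ f) (withHead⁺ _ f)
    pascal : ∀ m → (n C m) * cover m d + signedBound m ≡ (suc n C m) * cover m d
    pascal zero    = +-identityʳ _
    pascal (suc m) = trans (sym (*-distribʳ-+ (cover (suc m) d) (n C suc m) (n C m)))
      (cong (_* cover (suc m) d) (trans (+-comm (n C suc m) (n C m)) (nCk+nC[k+1]≡[n+1]C[k+1] n m)))

module Estimates where
  open CoverCount using (cover)
  open import Data.Nat
  open import Data.Nat.Properties
  open import Data.Nat.Combinatorics using (_C_; nCk+nC[k+1]≡[n+1]C[k+1])
  open import Data.Nat.Solver using (module +-*-Solver)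
  open import Relation.Binary.PropositionalEquality
  open +-*-Solver

  ^-distribʳ-* : ∀ a b n → (a * b) ^ n ≡ a ^ n * b ^ n
  ^-distribʳ-* a b zero    = refl
  ^-distribʳ-* a b (suc n) = trans (cong (a * b *_) (^-distribʳ-* a b n))
    (solve 4 (λ a b A B → a :* b :* (A :* B) := a :* A :* (b :* B)) refl a b (a ^ n) (b ^ n))

  -- Chernoff's bound cover m d ≤ (1 + t)^m / t^d for t = a/b ≤ 1, cleared of denominators.
  cover-chernoff : ∀ {a b} → a ≤ b → ∀ m d → cover m d * a ^ d * b ^ m ≤ (a + b) ^ m * b ^ d
  cover-chernoff {a} {b} a≤b zero d = begin
    1 * a ^ d * 1 ≡⟨ solve 1 (λ A → con 1 :* A :* con 1 := A) refl (a ^ d) ⟩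
    a ^ d         ≤⟨ ^-monoˡ-≤ d a≤b ⟩
    b ^ d         ≡⟨ sym (*-identityˡ (b ^ d)) ⟩
    1 * b ^ d     ∎
    where open ≤-Reasoning
  cover-chernoff a≤b (suc m) zero    = z≤n
  cover-chernoff {a} {b} a≤b (suc m) (suc d) = begin
    (X + Y) * (a * A) * (b * B)
      ≡⟨ solve 6 (λ X Y a A b B → (X :+ Y) :* (a :* A) :* (b :* B)
                   := b :* (X :* (a :* A) :* B) :+ (a :* b) :* (Y :* A :* B)) refl X Y a A b B ⟩
    b * (X * (a * A) * B) + (a * b) * (Y * A * B)
      ≤⟨ +-mono-≤ (*-monoʳ-≤ b (cover-chernoff a≤b m (suc d))) (*-monoʳ-≤ (a * b) (cover-chernoff a≤b m d)) ⟩
    b * (S * (b * D)) + (a * b) * (S * D)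
      ≡⟨ solve 4 (λ a b S D → b :* (S :* (b :* D)) :+ (a :* b) :* (S :* D) := ((a :+ b) :* S) :* (b :* D))
                 refl a b S D ⟩
    ((a + b) * S) * (b * D) ∎
    where
    open ≤-Reasoning
    X = cover m (suc d)
    Y = cover m d
    A = a ^ d
    B = b ^ m
    S = (a + b) ^ m
    D = b ^ d

  nCk≤[1+n]Ck : ∀ n k → n C k ≤ suc n C k
  nCk≤[1+n]Ck n zero    = ≤-refl
  nCk≤[1+n]Ck n (suc k) = subst (n C suc k ≤_) (nCk+nC[k+1]≡[n+1]C[k+1] n k) (m≤n+m _ _)

  k≤n⇒0<nCk : ∀ {n k} → k ≤ n → 0 < n C k
  k≤n⇒0<nCk {n}     {zero}  _         = ≤-refl
  k≤n⇒0<nCk {suc n} {suc k} (s≤s k≤n) =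
    subst (0 <_) (nCk+nC[k+1]≡[n+1]C[k+1] n k) (≤-trans (k≤n⇒0<nCk k≤n) (m≤m+n _ _))

  -- Choosing k of the 2n points, at most one from each of n pairs.
  nCk*2^k≤[n+n]Ck : ∀ n k → (n C k) * 2 ^ k ≤ (n + n) C k
  nCk*2^k≤[n+n]Ck zero    zero    = ≤-refl
  nCk*2^k≤[n+n]Ck zero    (suc k) = z≤n
  nCk*2^k≤[n+n]Ck (suc n) zero    = ≤-refl
  nCk*2^k≤[n+n]Ck (suc n) (suc k) = begin
    (suc n C suc k) * 2 ^ suc k
      ≡⟨ cong (_* 2 ^ suc k) (sym (nCk+nC[k+1]≡[n+1]C[k+1] n k)) ⟩
    (n C k + n C suc k) * (2 * 2 ^ k)
      ≡⟨ solve 3 (λ a b t → (a :+ b) :* (con 2 :* t) := con 2 :* (a :* t) :+ b :* (con 2 :* t))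
                 refl (n C k) (n C suc k) (2 ^ k) ⟩
    2 * ((n C k) * 2 ^ k) + (n C suc k) * 2 ^ suc k
      ≤⟨ +-mono-≤ (*-monoʳ-≤ 2 (nCk*2^k≤[n+n]Ck n k)) (nCk*2^k≤[n+n]Ck n (suc k)) ⟩
    2 * (2n C k) + 2n C suc k
      ≡⟨ solve 2 (λ x z → con 2 :* x :+ z := x :+ (x :+ z)) refl (2n C k) (2n C suc k) ⟩
    2n C k + (2n C k + 2n C suc k)
      ≤⟨ +-monoˡ-≤ _ (nCk≤[1+n]Ck 2n k) ⟩
    suc 2n C k + (2n C k + 2n C suc k)
      ≡⟨ cong (suc 2n C k +_) (nCk+nC[k+1]≡[n+1]C[k+1] 2n k) ⟩
    suc 2n C k + suc 2n C suc k
      ≡⟨ nCk+nC[k+1]≡[n+1]C[k+1] (suc 2n) k ⟩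
    suc (suc 2n) C suc k
      ≡⟨ cong (λ t → suc t C suc k) (sym (+-suc n n)) ⟩
    (suc n + suc n) C suc k ∎
    where
    open ≤-Reasoning
    2n = n + n

  bernoulli : ∀ u k → u ^ k * (u + k) ≤ u * suc u ^ k
  bernoulli u zero    = ≤-reflexive (solve 1 (λ u → con 1 :* (u :+ con 0) := u :* con 1) refl u)
  bernoulli u (suc k) = begin
    u * U * (u + suc k)       ≡⟨ solve 3 (λ u U k → u :* U :* (u :+ (con 1 :+ k)) := u :* (U :* (u :+ k)) :+ u :* U)
                                   refl u U k ⟩
    u * (U * (u + k)) + u * U ≤⟨ +-mono-≤ (*-monoʳ-≤ u (bernoulli u k)) (*-monoʳ-≤ u (^-monoˡ-≤ k (n≤1+n u))) ⟩
    u * (u * W) + u * W       ≡⟨ solve 2 (λ u W → u :* (u :* W) :+ u :* W := u :* ((con 1 :+ u) :* W)) refl u W ⟩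
    u * (suc u * W)           ∎
    where
    open ≤-Reasoning
    U = u ^ k
    W = suc u ^ k

  suc-^-suc≤ : ∀ x p → suc x ^ suc p ≤ x ^ suc p + suc p * suc x ^ p
  suc-^-suc≤ x zero    = ≤-reflexive (solve 1 (λ x → (con 1 :+ x) :* con 1 := x :* con 1 :+ con 1 :* con 1) refl x)
  suc-^-suc≤ x (suc p) = begin
    suc x * (suc x * S)
      ≤⟨ *-monoʳ-≤ (suc x) (suc-^-suc≤ x p) ⟩
    suc x * (x * X + suc p * S)
      ≡⟨ solve 4 (λ x X p S → (con 1 :+ x) :* (x :* X :+ (con 1 :+ p) :* S)
                   := x :* (x :* X) :+ x :* X :+ (con 1 :+ p) :* ((con 1 :+ x) :* S)) refl x X p S ⟩
    x * (x * X) + x * X + suc p * (suc x * S)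
      ≤⟨ +-monoˡ-≤ (suc p * (suc x * S)) (+-monoʳ-≤ (x * (x * X)) (^-monoˡ-≤ (suc p) (n≤1+n x))) ⟩
    x * (x * X) + suc x * S + suc p * (suc x * S)
      ≡⟨ solve 4 (λ x X p T → x :* (x :* X) :+ T :+ (con 1 :+ p) :* T := x :* (x :* X) :+ (con 2 :+ p) :* T)
                 refl x X p (suc x * S) ⟩
    x * (x * X) + suc (suc p) * (suc x * S) ∎
    where
    open ≤-Reasoning
    S = suc x ^ p
    X = x ^ p

  ^-dominates : ∀ {u v} c k → 0 < u → u < v → c * u ≤ k → c * u ^ k < v ^ k
  ^-dominates {u} {v} c k 0<u u<v cu≤k = <-≤-trans c*u^k<[1+u]^k (^-monoˡ-≤ k u<v)
    where
    instance
      u-nonZero : NonZero u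
      u-nonZero = >-nonZero 0<u
    c*u^k<[1+u]^k : c * u ^ k < suc u ^ k
    c*u^k<[1+u]^k = <-≤-trans (+-monoˡ-≤ (c * u ^ k) (m^n>0 u k)) (*-cancelˡ-≤ u (begin
      u * (u ^ k + c * u ^ k) ≡⟨ solve 3 (λ u U c → u :* (U :+ c :* U) := U :* (u :+ c :* u)) refl u (u ^ k) c ⟩
      u ^ k * (u + c * u)     ≤⟨ *-monoʳ-≤ (u ^ k) (+-monoʳ-≤ u cu≤k) ⟩
      u ^ k * (u + k)         ≤⟨ bernoulli u k ⟩
      u * suc u ^ k           ∎))
      where open ≤-Reasoning

  linear<exponential : ∀ c k → 4 * c + 4 ≤ k → c * suc k < 2 ^ k
  linear<exponential c k K≤k = subst (λ k → c * suc k < 2 ^ k) (m+[n∸m]≡n K≤k) (from-K (k ∸ K))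
    where
    K = 4 * c + 4
    from-K : ∀ t → c * suc (K + t) < 2 ^ (K + t)
    from-K zero = begin-strict
      c * suc (K + 0)         <⟨ m<m+n _ {9 + 7 * c} z<s ⟩
      c * suc (K + 0) + (9 + 7 * c)
        ≡⟨ solve 1 (λ c → c :* (con 1 :+ (con 4 :* c :+ con 4 :+ con 0)) :+ (con 9 :+ con 7 :* c)
                         := (con 1 :+ (con 2 :* c :+ con 2)) :* (con 1 :+ (con 2 :* c :+ con 2))) refl c ⟩
      suc a * suc a           ≤⟨ *-mono-≤ (1+a≤2^a) (1+a≤2^a) ⟩
      2 ^ a * 2 ^ a           ≡⟨ sym (^-distribˡ-+-* 2 a a) ⟩
      2 ^ (a + a)             ≡⟨ cong (2 ^_) (solve 1 (λ c → (con 2 :* c :+ con 2) :+ (con 2 :* c :+ con 2)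
                                                        := con 4 :* c :+ con 4 :+ con 0) refl c) ⟩
      2 ^ (K + 0)             ∎
      where
      open ≤-Reasoning
      a = 2 * c + 2
      1+a≤2^a : suc a ≤ 2 ^ a
      1+a≤2^a = subst₂ _≤_ (trans (cong (_* suc a) (^-zeroˡ a)) (*-identityˡ (suc a))) (*-identityˡ (2 ^ a))
                  (bernoulli 1 a)
    from-K (suc t) = begin-strict
      c * suc (K + suc t)          ≡⟨ cong (λ k → c * suc k) (+-suc K t) ⟩
      c * suc (suc j)              ≡⟨ *-suc c (suc j) ⟩
      c + c * suc j                <⟨ +-mono-≤-< (≤-trans (m≤m*n c (suc j)) (<⇒≤ (from-K t))) (from-K t) ⟩
      2 ^ j + 2 ^ j                ≡⟨ cong (2 ^ j +_) (sym (+-identityʳ (2 ^ j))) ⟩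
      2 ^ suc j                    ≡⟨ cong (2 ^_) (sym (+-suc K t)) ⟩
      2 ^ (K + suc t)              ∎
      where
      open ≤-Reasoning
      j = K + t

  -- For m ≥ (2 + 1/P) k, i.e. α k ≤ P m with α = 2P+1, Chernoff's bound with a = P and
  -- b = β = P+1 gives cover m k / 2^m ≤ (α/γ)^m (β/P)^k ≤ (u/v)^(k/P), where γ = 2β.
  module Exponents (p : ℕ) where
    P α β γ x : ℕ
    P = suc p
    α = P + suc P
    β = suc P
    γ = suc P + suc P
    x = 4 * P * P + 4 * P

    α*α≡1+x : α * α ≡ suc x
    α*α≡1+x = solve 1 (λ p → ((con 1 :+ p) :+ (con 2 :+ p)) :* ((con 1 :+ p) :+ (con 2 :+ p))
                         := con 1 :+ (con 4 :* (con 1 :+ p) :* (con 1 :+ p) :+ con 4 :* (con 1 :+ p))) refl p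

    γ*γ*P≡x*β : γ * γ * P ≡ x * β
    γ*γ*P≡x*β = solve 1 (λ p → ((con 2 :+ p) :+ (con 2 :+ p)) :* ((con 2 :+ p) :+ (con 2 :+ p)) :* (con 1 :+ p)
                           := (con 4 :* (con 1 :+ p) :* (con 1 :+ p) :+ con 4 :* (con 1 :+ p)) :* (con 2 :+ p)) refl p

    -- Since α² = 1 + x and γ² P = x β, this is u < v up to the factor β^P.
    α*[1+x]^P<γ*x^P : α * suc x ^ P < γ * x ^ P
    α*[1+x]^P<γ*x^P = +-cancelˡ-< (suc x * Z) (α * (suc x * Z)) (γ * x ^ P) (begin-strict
      suc x * Z + α * (suc x * Z) ≡⟨⟩
      γ * (suc x * Z)             ≤⟨ *-monoʳ-≤ γ (suc-^-suc≤ x p) ⟩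
      γ * (x ^ P + P * Z)         ≡⟨ *-distribˡ-+ γ (x ^ P) (P * Z) ⟩
      γ * x ^ P + γ * (P * Z)     <⟨ +-monoʳ-< (γ * x ^ P) (subst (_< suc x * Z) (*-assoc γ P Z)
                                       (*-monoˡ-< Z {{m^n≢0 (suc x) p}} γ*P<1+x)) ⟩
      γ * x ^ P + suc x * Z       ≡⟨ +-comm (γ * x ^ P) _ ⟩
      suc x * Z + γ * x ^ P       ∎)
      where
      open ≤-Reasoning
      Z = suc x ^ p
      γ*P<1+x : γ * P < suc x
      γ*P<1+x = s≤s (≤-trans (m≤m+n (γ * P) (2 * P * P + 2 * P)) (≤-reflexive
        (solve 1 (λ p → (con 2 :+ p :+ (con 2 :+ p)) :* (con 1 :+ p)
                        :+ (con 2 :* (con 1 :+ p) :* (con 1 :+ p) :+ con 2 :* (con 1 :+ p))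
                        := con 4 :* (con 1 :+ p) :* (con 1 :+ p) :+ con 4 :* (con 1 :+ p)) refl p)))

    u v : ℕ
    u = α ^ α * β ^ P
    v = γ ^ α * P ^ P

    u>0 : u > 0
    u>0 = *-mono-≤ (m^n>0 α α) (m^n>0 β P)

    ^-split : ∀ a → a ^ α ≡ a * (a * a) ^ P
    ^-split a = trans (^-distribˡ-+-* a P (suc P))
      (trans (solve 2 (λ A a → A :* (a :* A) := a :* (A :* A)) refl (a ^ P) a)
             (cong (a *_) (sym (^-distribʳ-* a a P))))

    u<v : u < v
    u<v = begin-strict
      α ^ α * β ^ P                 ≡⟨ cong (_* β ^ P) (trans (^-split α) (cong (λ t → α * t ^ P) α*α≡1+x)) ⟩
      α * suc x ^ P * β ^ P         <⟨ *-monoˡ-< (β ^ P) {{m^n≢0 β P}} α*[1+x]^P<γ*x^P ⟩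
      γ * x ^ P * β ^ P             ≡⟨ *-assoc γ (x ^ P) (β ^ P) ⟩
      γ * (x ^ P * β ^ P)           ≡⟨ cong (γ *_) (sym (^-distribʳ-* x β P)) ⟩
      γ * (x * β) ^ P               ≡⟨ cong (λ t → γ * t ^ P) (sym γ*γ*P≡x*β) ⟩
      γ * (γ * γ * P) ^ P           ≡⟨ cong (γ *_) (^-distribʳ-* (γ * γ) P P) ⟩
      γ * ((γ * γ) ^ P * P ^ P)     ≡⟨ sym (*-assoc γ ((γ * γ) ^ P) (P ^ P)) ⟩
      γ * (γ * γ) ^ P * P ^ P       ≡⟨ cong (_* P ^ P) (sym (^-split γ)) ⟩
      γ ^ α * P ^ P                 ∎
      where open ≤-Reasoning

    ^m^P : ∀ {m k} → α * k ≤ P * m → ∀ a → (a ^ m) ^ P ≡ (a ^ α) ^ k * a ^ (P * m ∸ α * k)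
    ^m^P {m} {k} αk≤Pm a = begin
      (a ^ m) ^ P           ≡⟨ ^-*-assoc a m P ⟩
      a ^ (m * P)           ≡⟨ cong (a ^_) (trans (*-comm m P) (sym (m+[n∸m]≡n αk≤Pm))) ⟩
      a ^ (α * k + e)       ≡⟨ ^-distribˡ-+-* a (α * k) e ⟩
      a ^ (α * k) * a ^ e   ≡⟨ cong (_* a ^ e) (sym (^-*-assoc a α k)) ⟩
      (a ^ α) ^ k * a ^ e   ∎
      where
      open ≡-Reasoning
      e = P * m ∸ α * k

    ^k^P : ∀ k b → (b ^ k) ^ P ≡ (b ^ P) ^ k
    ^k^P k b = trans (^-*-assoc b k P) (trans (cong (b ^_) (*-comm k P)) (sym (^-*-assoc b P k)))

    power-bound : ∀ q m k → α * k ≤ P * m → suc q ^ P * u ≤ k → suc q * α ^ m * β ^ k < γ ^ m * P ^ k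
    power-bound q m k αk≤Pm large = ≰⇒> (λ Y≤X → <⇒≱ X^P<Y^P (^-monoˡ-≤ P Y≤X))
      where
      open ≤-Reasoning
      c = suc q ^ P
      e = P * m ∸ α * k
      X^P<Y^P : (suc q * α ^ m * β ^ k) ^ P < (γ ^ m * P ^ k) ^ P
      X^P<Y^P = begin-strict
        (suc q * α ^ m * β ^ k) ^ P              ≡⟨ ^-distribʳ-* (suc q * α ^ m) (β ^ k) P ⟩
        (suc q * α ^ m) ^ P * (β ^ k) ^ P        ≡⟨ cong₂ _*_ (^-distribʳ-* (suc q) (α ^ m) P) (^k^P k β) ⟩
        c * (α ^ m) ^ P * (β ^ P) ^ k            ≡⟨ cong (λ t → c * t * (β ^ P) ^ k) (^m^P αk≤Pm α) ⟩
        c * ((α ^ α) ^ k * α ^ e) * (β ^ P) ^ k  ≡⟨ solve 4 (λ c a e b → c :* (a :* e) :* b := c :* (a :* b) :* e)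
                                                       refl c ((α ^ α) ^ k) (α ^ e) ((β ^ P) ^ k) ⟩
        c * ((α ^ α) ^ k * (β ^ P) ^ k) * α ^ e  ≡⟨ cong (λ t → c * t * α ^ e) (sym (^-distribʳ-* (α ^ α) (β ^ P) k)) ⟩
        c * u ^ k * α ^ e                        <⟨ *-monoˡ-< (α ^ e) {{m^n≢0 α e}} (^-dominates {u} {v} c k u>0 u<v large) ⟩
        v ^ k * α ^ e                            ≤⟨ *-monoʳ-≤ (v ^ k) (^-monoˡ-≤ e (n≤1+n α)) ⟩
        v ^ k * γ ^ e                            ≡⟨ cong (_* γ ^ e) (^-distribʳ-* (γ ^ α) (P ^ P) k) ⟩
        (γ ^ α) ^ k * (P ^ P) ^ k * γ ^ e        ≡⟨ solve 3 (λ a b e → a :* b :* e := a :* e :* b)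
                                                       refl ((γ ^ α) ^ k) ((P ^ P) ^ k) (γ ^ e) ⟩
        (γ ^ α) ^ k * γ ^ e * (P ^ P) ^ k        ≡⟨ sym (cong₂ _*_ (^m^P αk≤Pm γ) (^k^P k P)) ⟩
        (γ ^ m) ^ P * (P ^ k) ^ P                ≡⟨ sym (^-distribʳ-* (γ ^ m) (P ^ k) P) ⟩
        (γ ^ m * P ^ k) ^ P                      ∎

    cover-bound : ∀ q m k → α * k ≤ P * m → suc q ^ P * u ≤ k → cover m k * suc q < 2 ^ m
    cover-bound q m k αk≤Pm large = ≰⇒> λ 2^m≤ → <⇒≱ (power-bound q m k αk≤Pm large) (begin
      γ ^ m * P ^ k                       ≡⟨ cong (λ t → t ^ m * P ^ k) (solve 1 (λ b → b :+ b := con 2 :* b) refl β) ⟩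
      (2 * β) ^ m * P ^ k                 ≡⟨ cong (_* P ^ k) (^-distribʳ-* 2 β m) ⟩
      2 ^ m * β ^ m * P ^ k               ≤⟨ *-monoˡ-≤ (P ^ k) (*-monoˡ-≤ (β ^ m) 2^m≤) ⟩
      cover m k * suc q * β ^ m * P ^ k   ≡⟨ solve 4 (λ C s B A → C :* s :* B :* A := s :* (C :* A :* B))
                                               refl (cover m k) (suc q) (β ^ m) (P ^ k) ⟩
      suc q * (cover m k * P ^ k * β ^ m) ≤⟨ *-monoʳ-≤ (suc q) (cover-chernoff (n≤1+n P) m k) ⟩
      suc q * (α ^ m * β ^ k)             ≡⟨ sym (*-assoc (suc q) (α ^ m) (β ^ k)) ⟩
      suc q * α ^ m * β ^ k               ∎)
      where open ≤-Reasoning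

module Diagonal where
  open import Defs
  open Hull
  open import Algebra.Bundles using (CommutativeRing)
  open import Data.Nat as ℕ using (ℕ)
  open import Data.Fin using (Fin; zero; suc)
  open import Data.Fin.Properties using () renaming (_≟_ to _≟ᶠ_)
  open import Data.Integer as ℤ using ()
  open import Data.Rational as ℚ
    using (ℚ; 0ℚ; 1ℚ; _+_; _*_; _≤_; 1/_; *≤*; Positive; NonZero; NonNegative)
  open import Data.Rational.Properties
  open import Data.Vec as Vec using (Vec)
  open import Data.List as List using (List; []; _∷_; length)
  open import Data.List.Relation.Unary.Any as Any using (Any)
  import Data.List.Relation.Unary.Any.Properties as Anyₚ
  open import Data.List.Relation.Unary.All using ([]; _∷_)
  open import Data.Product using (_,_)
  open import Relation.Binary.PropositionalEquality
  open import Relation.Nullary using (yes; no)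
  open import Algebra.Properties.Semiring.Sum (CommutativeRing.semiring +-*-commutativeRing)
    using (sum; sum-cong-≗; ∑-distrib-+; *-distribʳ-sum; sum-replicate-zero)
  open import Algebra.Properties.CommutativeSemigroup
    (CommutativeRing.*-commutativeSemigroup +-*-commutativeRing) using (xy∙z≈xz∙y)

  toPoint : ∀ {k} → Cube k → Point k
  toPoint y j = sign (Vec.lookup y j)

  sumFin≡sum : ∀ n (f : Fin n → ℚ) → sumFin n f ≡ sum f
  sumFin≡sum ℕ.zero    f = refl
  sumFin≡sum (ℕ.suc n) f = cong (f zero +_) (sumFin≡sum n (λ i → f (suc i)))

  indicator : ∀ {n} → Fin n → ℚ → Fin n → ℚ
  indicator i₀ l i with i₀ ≟ᶠ i
  ... | yes _ = l
  ... | no _  = 0ℚ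

  sum-indicator : ∀ {n} (i₀ : Fin n) l (f : Fin n → ℚ) → sum (λ i → indicator i₀ l i * f i) ≡ l * f i₀
  sum-indicator {ℕ.suc n} zero l f = trans
    (cong (l * f zero +_) (trans (sum-cong-≗ (λ i → *-zeroˡ (f (suc i)))) (sum-replicate-zero n)))
    (+-identityʳ _)
  sum-indicator (suc i₀) l f = trans
    (cong₂ _+_ (*-zeroˡ (f zero))
      (trans (sum-cong-≗ (λ i → cong (_* f (suc i)) (indicator-suc i)))
             (sum-indicator i₀ l (λ i → f (suc i)))))
    (+-identityˡ _)
    where
    indicator-suc : ∀ i → indicator (suc i₀) l (suc i) ≡ indicator i₀ l i
    indicator-suc i with i₀ ≟ᶠ i
    ... | yes refl = refl
    ... | no _     = refl

  evaluate : ∀ {k} → (Point k → ℚ) → Combination k → ℚ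
  evaluate g []            = 0ℚ
  evaluate g ((l , v) ∷ W) = l * g v + evaluate g W

  totalWeight≡evaluate : ∀ {k} (W : Combination k) → totalWeight W ≡ evaluate (λ _ → 1ℚ) W
  totalWeight≡evaluate []            = refl
  totalWeight≡evaluate ((l , v) ∷ W) = cong₂ _+_ (sym (*-identityʳ l)) (totalWeight≡evaluate W)

  combine≡evaluate : ∀ {k} (W : Combination k) j → combine W j ≡ evaluate (λ v → v j) W
  combine≡evaluate []            j = refl
  combine≡evaluate ((l , v) ∷ W) j = cong (l * v j +_) (combine≡evaluate W j)

  module _ {k : ℕ} (Y : List (Cube k)) where

    index : ∀ {v} → v ∈≗ List.map toPoint Y → Fin (length Y)
    index v∈ = Any.index (Anyₚ.map⁻ v∈)

    index-≗ : ∀ {v} (v∈ : v ∈≗ List.map toPoint Y) → v ≗ toPoint (List.lookup Y (index v∈))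
    index-≗ v∈ = Anyₚ.lookup-index (Anyₚ.map⁻ v∈)

    weights : (W : Combination k) → ConicOver (List.map toPoint Y) W → Fin (length Y) → ℚ
    weights []            []                i = 0ℚ
    weights ((l , v) ∷ W) ((_ , v∈) ∷ conic) i = indicator (index v∈) l i + weights W conic i

    weights-nonNeg : ∀ W conic i → 0ℚ ≤ weights W conic i
    weights-nonNeg []            []                  i = ≤-refl
    weights-nonNeg ((l , v) ∷ W) ((l≥0 , v∈) ∷ conic) i =
      +-mono-≤ (indicator-nonNeg (index v∈) i) (weights-nonNeg W conic i)
      where
      indicator-nonNeg : ∀ i₀ i → 0ℚ ≤ indicator i₀ l i
      indicator-nonNeg i₀ i with i₀ ≟ᶠ i
      ... | yes _ = l≥0
      ... | no _  = ≤-refl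

    sum-weights : ∀ W conic (f : Fin (length Y) → ℚ) (g : Point k → ℚ) →
      (∀ {v} (v∈ : v ∈≗ List.map toPoint Y) → g v ≡ f (index v∈)) →
      sum (λ i → weights W conic i * f i) ≡ evaluate g W
    sum-weights [] [] f g g≡f = trans (sum-cong-≗ (λ i → *-zeroˡ (f i))) (sum-replicate-zero (length Y))
    sum-weights ((l , v) ∷ W) ((_ , v∈) ∷ conic) f g g≡f = begin
      sum (λ i → (indicator (index v∈) l i + weights W conic i) * f i)
        ≡⟨ sum-cong-≗ (λ i → *-distribʳ-+ (f i) (indicator (index v∈) l i) (weights W conic i)) ⟩
      sum (λ i → indicator (index v∈) l i * f i + weights W conic i * f i)
        ≡⟨ ∑-distrib-+ (λ i → indicator (index v∈) l i * f i) (λ i → weights W conic i * f i) ⟩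
      sum (λ i → indicator (index v∈) l i * f i) + sum (λ i → weights W conic i * f i)
        ≡⟨ cong₂ _+_ (trans (sum-indicator (index v∈) l f) (cong (l *_) (sym (g≡f v∈))))
                     (sum-weights W conic f g g≡f) ⟩
      l * g v + evaluate g W ∎
      where open ≡-Reasoning

    sum-weights≡totalWeight : ∀ W conic → sum (weights W conic) ≡ totalWeight W
    sum-weights≡totalWeight W conic = begin
      sum (λ i → weights W conic i)       ≡⟨ sum-cong-≗ (λ i → sym (*-identityʳ (weights W conic i))) ⟩
      sum (λ i → weights W conic i * 1ℚ)  ≡⟨ sum-weights W conic _ _ (λ _ → refl) ⟩
      evaluate (λ _ → 1ℚ) W               ≡⟨ sym (totalWeight≡evaluate W) ⟩
      totalWeight W                       ∎
      where open ≡-Reasoning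

    sum-weights≡combine : ∀ W conic j →
      sum (λ i → weights W conic i * toPoint (List.lookup Y i) j) ≡ combine W j
    sum-weights≡combine W conic j =
      trans (sum-weights W conic _ (λ v → v j) (λ v∈ → index-≗ v∈ j)) (sym (combine≡evaluate W j))

    0∈Conv⇒meetsDiagonal : 0∈Conv (List.map toPoint Y) → MeetsDiagonal Y
    0∈Conv⇒meetsDiagonal (W , conic , pos , W≗0) =
      w , 0ℚ , w≥0 , sum-w≡1 , *≤* ℤ.-≤+ , *≤* (ℤ.+≤+ ℕ.z≤n) , sum-w-sign≡0
      where
      Λ = totalWeight W
      instance
        Λ-positive : Positive Λ
        Λ-positive = ℚ.positive pos
        Λ-nonZero : NonZero Λ
        Λ-nonZero = pos⇒nonZero Λ
        1/Λ-nonNeg : NonNegative (1/ Λ)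
        1/Λ-nonNeg = pos⇒nonNeg (1/ Λ) {{1/pos⇒pos Λ}}
      a = weights W conic
      w : Fin (length Y) → ℚ
      w i = a i * 1/ Λ
      w≥0 : ∀ i → 0ℚ ≤ w i
      w≥0 i = subst (_≤ w i) (*-zeroˡ (1/ Λ)) (*-monoʳ-≤-nonNeg (1/ Λ) (weights-nonNeg W conic i))
      sum-w≡1 : sumFin (length Y) w ≡ 1ℚ
      sum-w≡1 = begin
        sumFin (length Y) w  ≡⟨ sumFin≡sum _ w ⟩
        sum w                ≡⟨ sym (*-distribʳ-sum (1/ Λ) a) ⟩
        sum a * 1/ Λ         ≡⟨ cong (_* 1/ Λ) (sum-weights≡totalWeight W conic) ⟩
        Λ * 1/ Λ             ≡⟨ *-inverseʳ Λ ⟩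
        1ℚ                   ∎
        where open ≡-Reasoning
      sum-w-sign≡0 : ∀ j → sumFin (length Y) (λ i → w i * toPoint (List.lookup Y i) j) ≡ 0ℚ
      sum-w-sign≡0 j = begin
        sumFin (length Y) (λ i → w i * s i)  ≡⟨ sumFin≡sum _ (λ i → w i * s i) ⟩
        sum (λ i → a i * 1/ Λ * s i)         ≡⟨ sum-cong-≗ (λ i → xy∙z≈xz∙y (a i) (1/ Λ) (s i)) ⟩
        sum (λ i → a i * s i * 1/ Λ)         ≡⟨ sym (*-distribʳ-sum (1/ Λ) (λ i → a i * s i)) ⟩
        sum (λ i → a i * s i) * 1/ Λ         ≡⟨ cong (_* 1/ Λ) (trans (sum-weights≡combine W conic j) (W≗0 j)) ⟩
        0ℚ * 1/ Λ                            ≡⟨ *-zeroˡ (1/ Λ) ⟩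
        0ℚ                                   ∎
        where
        open ≡-Reasoning
        s : Fin (length Y) → ℚ
        s i = toPoint (List.lookup Y i) j

module CubeEncoding where
  open import Defs
  open ListFacts
  open Hull
  open SignedSelection
  open CoverCount
  open Diagonal
  open import Data.Bool as Bool using (Bool; true; false; not)
  open import Data.Bool.Properties using (not-involutive)
  open import Data.Nat using (ℕ; zero; suc; _+_; _*_; _^_; _∸_; _≤_; z≤n)
  open import Data.Nat.Properties using (≤-antisym; +-suc; +-identityʳ; *-suc)
  open import Data.Nat.Combinatorics using (_C_)
  open import Data.Maybe using (Maybe; nothing; just)
  open import Data.Sign as Sign using (Sign)
  open import Data.Integer as ℤ using ()
  open import Data.Rational using (0ℚ; 1ℚ; -_; *≤*) renaming (_+_ to _+ℚ_; _≤_ to _≤ℚ_)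
  open import Data.Rational.Properties using (positive⁻¹; *-identityˡ; +-inverseʳ)
    renaming (+-identityʳ to +ℚ-identityʳ)
  open import Data.Vec as Vec using (Vec; []; _∷_)
  import Data.Vec.Properties as Vecₚ
  import Data.Vec.Relation.Unary.All.Properties as VecAllₚ
  import Data.Vec.Relation.Unary.Any as VecAny
  import Data.Vec.Relation.Unary.Any.Properties as VecAnyₚ
  open import Data.Vec.Relation.Unary.AllPairs using ([]; _∷_)
  open import Data.List as List using (List; []; _∷_; length; _++_)
  open import Data.List.Properties using (length-++; length-map)
  open import Data.List.Membership.Propositional using (_∈_; _∉_)
  open import Data.List.Membership.Propositional.Properties using (∈-map⁺; ∈-map⁻; ∈-++⁺ˡ; ∈-++⁺ʳ)
  import Data.List.Membership.DecPropositional as DecMembership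
  open import Data.List.Relation.Binary.Subset.Propositional using (_⊆_)
  open import Data.List.Relation.Unary.Any as Any using (Any; here)
  import Data.List.Relation.Unary.Any.Properties as Anyₚ
  open import Data.List.Relation.Unary.All as All using (All; []; _∷_)
  import Data.List.Relation.Unary.All.Properties as Allₚ
  open import Data.List.Relation.Unary.AllPairs using (AllPairs)
  open import Data.List.Relation.Unary.Unique.Propositional using (Unique; []; _∷_)
  import Data.List.Relation.Unary.Unique.Propositional.Properties as Uniqueₚ
  open import Data.Product using (Σ-syntax; _×_; _,_)
  open import Data.Sum using (_⊎_; inj₁; inj₂)
  open import Data.Empty using (⊥-elim)
  open import Function using (_∘_)
  open import Function.Definitions using (Injective)
  open import Relation.Binary.PropositionalEquality
  open import Relation.Nullary using (¬_; yes; no)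

  antipode : ∀ {k} → Cube k → Cube k
  antipode = Vec.map not

  antipode-involutive : ∀ {k} (y : Cube k) → antipode (antipode y) ≡ y
  antipode-involutive []      = refl
  antipode-involutive (b ∷ y) = cong₂ _∷_ (not-involutive b) (antipode-involutive y)

  antipode-injective : ∀ {k} → Injective _≡_ _≡_ (antipode {k})
  antipode-injective {x = x} {y} eq =
    trans (sym (antipode-involutive x)) (trans (cong antipode eq) (antipode-involutive y))

  toPoint-antipode : ∀ {k} (y : Cube k) → toPoint (antipode y) ≗ negate (toPoint y)
  toPoint-antipode y j = trans (cong sign (Vecₚ.lookup-map j not y)) (sign-not (Vec.lookup y j))
    where
    sign-not : ∀ b → sign (not b) ≡ - sign b
    sign-not true  = refl
    sign-not false = refl

  0∈Conv-antipodal : ∀ {k} {Y : List (Cube k)} {p} → p ∈ Y → antipode p ∈ Y → 0∈Conv (List.map toPoint Y)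
  0∈Conv-antipodal {p = p} p∈Y -p∈Y =
    (1ℚ , toPoint p) ∷ (1ℚ , toPoint (antipode p)) ∷ [] ,
    (0≤1 , toPoint∈ p∈Y) ∷ (0≤1 , toPoint∈ -p∈Y) ∷ [] ,
    positive⁻¹ _ ,
    λ j → trans (cong₂ _+ℚ_ (*-identityˡ (toPoint p j))
                            (trans (+ℚ-identityʳ _) (trans (*-identityˡ _) (toPoint-antipode p j))))
                (+-inverseʳ (toPoint p j))
    where
    0≤1 : 0ℚ ≤ℚ 1ℚ
    0≤1 = *≤* (ℤ.+≤+ z≤n)
    toPoint∈ : ∀ {y Y} → y ∈ Y → toPoint y ∈≗ List.map toPoint Y
    toPoint∈ y∈ = Anyₚ.map⁺ (Any.map (λ { refl _ → refl }) y∈)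

  allCubes : (k : ℕ) → List (Cube k)
  allCubes zero    = [] ∷ []
  allCubes (suc k) = List.map (false ∷_) (allCubes k) ++ List.map (true ∷_) (allCubes k)

  allButTop : (k : ℕ) → List (Cube k)
  allButTop zero    = []
  allButTop (suc k) = List.map (false ∷_) (allCubes k) ++ List.map (true ∷_) (allButTop k)

  ∈-allCubes : ∀ {k} (y : Cube k) → y ∈ allCubes k
  ∈-allCubes []          = here refl
  ∈-allCubes (false ∷ y) = ∈-++⁺ˡ (∈-map⁺ (false ∷_) (∈-allCubes y))
  ∈-allCubes (true ∷ y)  = ∈-++⁺ʳ _ (∈-map⁺ (true ∷_) (∈-allCubes y))

  ∈-allButTop : ∀ {k} (y : Cube k) → y ≢ Vec.replicate k true → y ∈ allButTop k
  ∈-allButTop []          y≢top = ⊥-elim (y≢top refl)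
  ∈-allButTop (false ∷ y) y≢top = ∈-++⁺ˡ (∈-map⁺ (false ∷_) (∈-allCubes y))
  ∈-allButTop (true ∷ y)  y≢top = ∈-++⁺ʳ _ (∈-map⁺ (true ∷_) (∈-allButTop y (y≢top ∘ cong (true ∷_))))

  Unique-halves : ∀ {k} {xs ys : List (Cube k)} → Unique xs → Unique ys →
                  Unique (List.map (false ∷_) xs ++ List.map (true ∷_) ys)
  Unique-halves u v =
    Uniqueₚ.++⁺ (Uniqueₚ.map⁺ Vecₚ.∷-injectiveʳ u) (Uniqueₚ.map⁺ Vecₚ.∷-injectiveʳ v) disjoint
    where
    disjoint : ∀ {y} → ¬ (y ∈ List.map (false ∷_) _ × y ∈ List.map (true ∷_) _)
    disjoint (y∈ , y∈′) with ∈-map⁻ (false ∷_) y∈ | ∈-map⁻ (true ∷_) y∈′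
    ... | _ , _ , refl | _ , _ , ()

  Unique-allCubes : ∀ k → Unique (allCubes k)
  Unique-allCubes zero    = [] ∷ []
  Unique-allCubes (suc k) = Unique-halves (Unique-allCubes k) (Unique-allCubes k)

  Unique-allButTop : ∀ k → Unique (allButTop k)
  Unique-allButTop zero    = []
  Unique-allButTop (suc k) = Unique-halves (Unique-allCubes k) (Unique-allButTop k)

  length-halves : ∀ {k} (xs ys : List (Cube k)) →
                  length (List.map (false ∷_) xs ++ List.map (true ∷_) ys) ≡ length xs + length ys
  length-halves xs ys = trans (length-++ (List.map (false ∷_) xs)) (cong₂ _+_ (length-map _ xs) (length-map _ ys))

  length-allCubes : ∀ k → length (allCubes k) ≡ 2 ^ k
  length-allCubes zero    = refl
  length-allCubes (suc k) = trans (length-halves (allCubes k) (allCubes k))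
    (trans (cong₂ _+_ (length-allCubes k) (length-allCubes k)) (cong (2 ^ k +_) (sym (+-identityʳ _))))

  suc-length-allButTop : ∀ k → suc (length (allButTop k)) ≡ 2 ^ k
  suc-length-allButTop zero    = refl
  suc-length-allButTop (suc k) = trans (cong suc (length-halves (allCubes k) (allButTop k)))
    (trans (sym (+-suc _ _)) (trans (cong₂ _+_ (length-allCubes k) (suc-length-allButTop k))
      (cong (2 ^ k +_) (sym (+-identityʳ _)))))

  -- One point of each antipodal pair of Q*_(k+1): the one with first coordinate true.
  representatives : (k : ℕ) → List (Cube (suc k))
  representatives k = List.map (true ∷_) (allButTop k)

  Represents : ∀ {k} → Cube k → Cube k → Set
  Represents y p = y ≡ p ⊎ y ≡ antipode p

  representatives-complete : ∀ {k} (y : Cube (suc k)) → InQ* y → Any (Represents y) (representatives k)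
  representatives-complete (true ∷ y) (y≢top , _) =
    Anyₚ.map⁺ (Any.map (λ { refl → inj₁ refl }) (∈-allButTop y (λ y≡ → y≢top (cong (true ∷_) y≡))))
  representatives-complete {k} (false ∷ y) (_ , y≢bottom) =
    Anyₚ.map⁺ (Any.map (λ { refl → inj₂ (cong (false ∷_) (sym (antipode-involutive y))) })
                       (∈-allButTop (antipode y) -y≢top))
    where
    -y≢top : antipode y ≢ Vec.replicate k true
    -y≢top -y≡top = y≢bottom (cong (false ∷_) (begin
      y                              ≡⟨ sym (antipode-involutive y) ⟩
      antipode (antipode y)          ≡⟨ cong antipode -y≡top ⟩
      antipode (Vec.replicate k true) ≡⟨ Vecₚ.map-replicate not true k ⟩
      Vec.replicate k false          ∎))
      where open ≡-Reasoning

  suc-length-representatives : ∀ k → suc (length (representatives k)) ≡ 2 ^ k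
  suc-length-representatives k = trans (cong suc (length-map _ (allButTop k))) (suc-length-allButTop k)

  N≡2*length-representatives : ∀ k → N (suc k) ≡ length (representatives k) + length (representatives k)
  N≡2*length-representatives k = begin
    2 ^ suc k ∸ 2       ≡⟨ cong (λ t → 2 * t ∸ 2) (sym (suc-length-representatives k)) ⟩
    2 * suc n ∸ 2       ≡⟨ cong (_∸ 2) (trans (*-suc 2 n) (cong (λ t → 2 + (n + t)) (+-identityʳ n))) ⟩
    n + n               ∎
    where
    open ≡-Reasoning
    n = length (representatives k)

  module _ {k : ℕ} where
    open DecMembership (λ (x y : Cube k) → Vecₚ.≡-dec Bool._≟_ x y) using (_∈?_)

    AntipodeFree : List (Cube k) → Set
    AntipodeFree Y = ∀ {p} → p ∈ Y → antipode p ∉ Y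

    encode : List (Cube k) → Cube k → Maybe Sign
    encode Y p with p ∈? Y
    ... | yes _ = just Sign.+
    ... | no _ with antipode p ∈? Y
    ...   | yes _ = just Sign.-
    ...   | no _  = nothing

    encode-sound : ∀ Y {p s} → encode Y p ≡ just s → signed antipode s p ∈ Y
    encode-sound Y {p} eq with p ∈? Y
    encode-sound Y refl | yes p∈Y = p∈Y
    ... | no _ with antipode p ∈? Y
    encode-sound Y refl | no _ | yes -p∈Y = -p∈Y
    encode-sound Y ()   | no _ | no _

    encode-complete : ∀ {Y y p} → AntipodeFree Y → y ∈ Y → Represents y p →
                      Σ[ s ∈ Sign ] encode Y p ≡ just s × signed antipode s p ≡ y
    encode-complete {Y} {p = p} free y∈Y (inj₁ refl) with p ∈? Y
    ... | yes _   = Sign.+ , refl , refl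
    ... | no p∉Y  = ⊥-elim (p∉Y y∈Y)
    encode-complete {Y} {p = p} free y∈Y (inj₂ refl) with p ∈? Y
    ... | yes p∈Y = ⊥-elim (free p∈Y y∈Y)
    ... | no _ with antipode p ∈? Y
    ...   | yes _    = Sign.- , refl , refl
    ...   | no -p∉Y = ⊥-elim (-p∉Y y∈Y)

  antipodeFree : ∀ {k} {Y : List (Cube k)} → ¬ MeetsDiagonal Y → AntipodeFree Y
  antipodeFree ¬meets p∈Y -p∈Y = ¬meets (0∈Conv⇒meetsDiagonal _ (0∈Conv-antipodal p∈Y -p∈Y))

  module FamilyBound (k m : ℕ) where

    n : ℕ
    n = length (representatives k)

    P : Vec (Cube (suc k)) n
    P = Vec.fromList (representatives k)

    code : List (Cube (suc k)) → Pattern n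
    code Y = Vec.map (encode Y) P

    Member : List (Cube (suc k)) → Set
    Member Y = IsSubsetQ* (suc k) m Y × ¬ MeetsDiagonal Y

    select-code-⊆ : ∀ Y → select antipode (code Y) P ⊆ Y
    select-code-⊆ Y = select-⊆ (encode Y) (encode-sound Y) P

    select-code-⊇ : ∀ {Y} → Member Y → Y ⊆ select antipode (code Y) P
    select-code-⊇ {Y} ((_ , inQ* , _) , ¬meets) y∈Y = ∈-select (encode Y) P
      (VecAny.map (encode-complete (antipodeFree ¬meets) y∈Y)
        (VecAnyₚ.fromList⁺ (representatives-complete _ (All.lookup inQ* y∈Y))))

    Unique-select-code : ∀ Y → Unique (select antipode (code Y) P)
    Unique-select-code Y = Unique-select antipode-injective heads-true (code Y)
      (VecAllₚ.fromList⁺ (Allₚ.map⁺ (All.universal (λ _ → refl) (allButTop k))))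
      (Unique-fromList (Uniqueₚ.map⁺ Vecₚ.∷-injectiveʳ (Unique-allButTop k)))
      where
      heads-true : ∀ {x y : Cube (suc k)} → Vec.head x ≡ true → Vec.head y ≡ true → antipode x ≢ y
      heads-true {true ∷ _} {true ∷ _} refl refl ()

    code-feasible : ∀ {Y} → Member Y → Feasible m (Vec.map toPoint P) (code Y)
    code-feasible {Y} member@((unique , _ , length≡m) , ¬meets) = feasible weight≡m 0∉Conv
      where
      weight≡m : weight (code Y) ≡ m
      weight≡m = begin
        weight (code Y)                         ≡⟨ sym (length-select antipode (code Y) P) ⟩
        length (select antipode (code Y) P)     ≡⟨ ≤-antisym
          (Unique-⊆⇒length≤ (Unique-select-code Y) (select-code-⊆ Y))
          (Unique-⊆⇒length≤ unique (select-code-⊇ member)) ⟩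
        length Y                                ≡⟨ length≡m ⟩
        m                                       ∎
        where open ≡-Reasoning
      toPoints-⊆ : select negate (code Y) (Vec.map toPoint P) ⊆≗ List.map toPoint Y
      toPoints-⊆ v∈ with u , u∈ , v≗u ← select-map toPoint toPoint-antipode (code Y) P v∈ =
        Anyₚ.map⁺ (Any.map (λ { refl → v≗u }) (select-code-⊆ Y u∈))
      0∉Conv : ¬ 0∈Conv (select negate (code Y) (Vec.map toPoint P))
      0∉Conv 0∈ = ¬meets (0∈Conv⇒meetsDiagonal Y (0∈Conv-mono toPoints-⊆ 0∈))

    code-injective : ∀ {Y Z} → Member Y → Member Z → code Y ≡ code Z → SameSet Y Z
    code-injective {Y} {Z} mY mZ eq x =
      (λ x∈Y → select-code-⊆ Z (subst (λ c → x ∈ select antipode c P) eq (select-code-⊇ mY x∈Y))) ,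
      (λ x∈Z → select-code-⊆ Y (subst (λ c → x ∈ select antipode c P) (sym eq) (select-code-⊇ mZ x∈Z)))

    Unique-codes : ∀ {L} → All Member L → AllPairs (λ Y Z → ¬ SameSet Y Z) L → Unique (List.map code L)
    Unique-codes []          []          = []
    Unique-codes (mY ∷ mL) (Y≁L ∷ ≁L) =
      Allₚ.map⁺ (All.zipWith (λ (mZ , Y≁Z) eq → Y≁Z (code-injective mY mZ eq)) (mL , Y≁L)) ∷ Unique-codes mL ≁L

    family-bound : ∀ L → DisjointFamily (suc k) m L → length L ≤ (n C m) * cover m (suc k)
    family-bound L (members , distinct) = subst (_≤ (n C m) * cover m (suc k)) (length-map code L)
      (count-feasible n m (Vec.map toPoint P) (List.map code L)
        (Unique-codes members distinct) (Allₚ.map⁺ (All.map code-feasible members)))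

module Ceiling where
  open import Defs using (mOf)
  open import Data.Nat as ℕ using (ℕ; zero; suc; _+_; _*_; _≤_; _<_; z≤n; s≤s)
  open import Data.Nat.Properties
  open import Data.Nat.Solver using (module +-*-Solver)
  open import Data.Nat.Coprimality using (Coprime)
  open import Data.Integer as ℤ using (ℤ; +_; +[1+_]; -[1+_])
  import Data.Integer.Properties as ℤₚ
  open import Data.Integer.DivMod using (a≡a%n+[a/n]*n; n%d<d)
  import Data.Integer.Solver as ℤSolver
  open import Data.Rational as ℚ using (ℚ; mkℚ; 0ℚ; toℚᵘ; ceiling; floor)
  import Data.Rational.Properties as ℚₚ
  open import Data.Rational.Unnormalised as ℚᵘ using (ℚᵘ; mkℚᵘ; *≡*)
  import Data.Rational.Unnormalised.Properties as ℚᵘₚ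
  open import Data.Product using (Σ-syntax; _×_; _,_; proj₁; proj₂)
  open import Relation.Binary.PropositionalEquality

  nonNeg-factor : ∀ (c : ℤ) d X → c ℤ.* + suc d ≡ + X → Σ[ m ∈ ℕ ] c ≡ + m × m * suc d ≡ X
  nonNeg-factor (+ m)      d X eq = m , refl , ℤₚ.+-injective (trans (ℤₚ.pos-* m (suc d)) eq)
  nonNeg-factor -[1+ _ ]   d X ()

  -- ceiling p = - floor (- p), and floor is integer division rounding down.
  ceiling-nonNeg : ∀ A d .(c : Coprime A (suc d)) →
    Σ[ m ∈ ℕ ] Σ[ r ∈ ℕ ] ceiling (mkℚ (+ A) d c) ≡ + m × m * suc d ≡ A + r × r < suc d
  ceiling-nonNeg A d c = from-factor (nonNeg-factor (ℤ.- f) d (A + r) -f*D≡A+r)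
    where
    -A = ℤ.- (+ A)
    D = + suc d
    f = -A ℤ./ D
    r = -A ℤ.% D
    floor-neg : ∀ A .{c : Coprime A (suc d)} → floor (ℚ.- mkℚ (+ A) d c) ≡ (ℤ.- (+ A)) ℤ./ D
    floor-neg zero    = refl
    floor-neg (suc A) = refl
    -f*D≡A+r : (ℤ.- f) ℤ.* D ≡ + (A + r)
    -f*D≡A+r = begin
      (ℤ.- f) ℤ.* D               ≡⟨ solve 3 (λ f D r → (:- f) :* D := :- (r :+ f :* D) :+ r) refl f D (+ r) ⟩
      ℤ.- (+ r ℤ.+ f ℤ.* D) ℤ.+ + r ≡⟨ cong (λ t → ℤ.- t ℤ.+ + r) (sym (a≡a%n+[a/n]*n -A D)) ⟩
      ℤ.- -A ℤ.+ + r              ≡⟨ cong (ℤ._+ + r) (ℤₚ.neg-involutive (+ A)) ⟩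
      + A ℤ.+ + r                 ≡⟨ sym (ℤₚ.pos-+ A r) ⟩
      + (A + r)                   ∎
      where
      open ≡-Reasoning
      open ℤSolver.+-*-Solver
    from-factor : Σ[ m ∈ ℕ ] ℤ.- f ≡ + m × m * suc d ≡ A + r →
      Σ[ m ∈ ℕ ] Σ[ r ∈ ℕ ] ceiling (mkℚ (+ A) d c) ≡ + m × m * suc d ≡ A + r × r < suc d
    from-factor (m , -f≡m , m*D≡A+r) = m , r , trans (cong ℤ.-_ (floor-neg A)) -f≡m , m*D≡A+r , n%d<d -A D

  ceiling-bounds : ∀ (x : ℚ) S p → toℚᵘ x ℚᵘ.≃ mkℚᵘ (+ S) p →
                   S ≤ ℤ.∣ ceiling x ∣ * suc p × ℤ.∣ ceiling x ∣ * suc p < S + suc p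
  ceiling-bounds (mkℚ n d c) S p (*≡* eq) with nonNeg-factor n p (S * suc d) (trans eq (sym (ℤₚ.pos-* S (suc d))))
  ceiling-bounds (mkℚ .(+ A) d c) S p _ | A , refl , A*P≡S*D with ceiling-nonNeg A d c
  ... | m , r , ceiling≡ , m*D≡A+r , r<D rewrite ceiling≡ = S≤m*P , m*P<S+P
    where
    open +-*-Solver
    P = suc p
    D = suc d
    m*P*D≡S*D+r*P : m * P * D ≡ S * D + r * P
    m*P*D≡S*D+r*P = begin
      m * P * D       ≡⟨ solve 3 (λ m P D → m :* P :* D := m :* D :* P) refl m P D ⟩
      m * D * P       ≡⟨ cong (_* P) m*D≡A+r ⟩
      (A + r) * P     ≡⟨ *-distribʳ-+ P A r ⟩
      A * P + r * P   ≡⟨ cong (_+ r * P) A*P≡S*D ⟩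
      S * D + r * P   ∎
      where open ≡-Reasoning
    S≤m*P : S ≤ m * P
    S≤m*P = *-cancelʳ-≤ S (m * P) D (subst (S * D ≤_) (sym m*P*D≡S*D+r*P) (m≤m+n _ _))
    m*P<S+P : m * P < S + P
    m*P<S+P = *-cancelʳ-< D (m * P) (S + P) (begin-strict
      m * P * D       ≡⟨ m*P*D≡S*D+r*P ⟩
      S * D + r * P   <⟨ +-monoʳ-< (S * D) (*-monoˡ-< P r<D) ⟩
      S * D + D * P   ≡⟨ solve 3 (λ S D P → S :* D :+ D :* P := (S :+ P) :* D) refl S D P ⟩
      (S + P) * D     ∎)
      where open ≤-Reasoning

  [2+a/P]*k≃[2P+a]k/P : ∀ a-1 p .{c : Coprime (suc a-1) (suc p)} k → let P = suc p; a = suc a-1 in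
    toℚᵘ (((+ 2) ℚ./ 1 ℚ.+ mkℚ +[1+ a-1 ] p c) ℚ.* ((+ k) ℚ./ 1)) ℚᵘ.≃ mkℚᵘ (+ ((2 * P + a) * k)) p
  [2+a/P]*k≃[2P+a]k/P a-1 p {c} k = ℚᵘₚ.≃-trans (ℚₚ.toℚᵘ-homo-* ((+ 2) ℚ./ 1 ℚ.+ ε) ((+ k) ℚ./ 1))
    (ℚᵘₚ.≃-trans (ℚᵘₚ.*-cong (ℚₚ.toℚᵘ-homo-+ ((+ 2) ℚ./ 1) ε) (ℚₚ.toℚᵘ-fromℚᵘ (mkℚᵘ (+ k) 0)))
      (*≡* (trans (cong (ℤ._* + P) ↥y≡S) (cong (+ S ℤ.*_) (sym ↧y≡P)))))
    where
    ε = mkℚ +[1+ a-1 ] p c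
    P = suc p
    a = suc a-1
    S = (2 * P + a) * k
    y : ℚᵘ
    y = (mkℚᵘ (+ 2) 0 ℚᵘ.+ mkℚᵘ +[1+ a-1 ] p) ℚᵘ.* mkℚᵘ (+ k) 0
    ↥y≡S : ℚᵘ.↥ y ≡ + S
    ↥y≡S = begin
      (+ 2 ℤ.* + P ℤ.+ + a ℤ.* + 1) ℤ.* + k ≡⟨ cong (λ t → (+ 2 ℤ.* + P ℤ.+ t) ℤ.* + k) (ℤₚ.*-identityʳ (+ a)) ⟩
      (+ 2 ℤ.* + P ℤ.+ + a) ℤ.* + k          ≡⟨ cong (λ t → (t ℤ.+ + a) ℤ.* + k) (sym (ℤₚ.pos-* 2 P)) ⟩
      (+ (2 * P) ℤ.+ + a) ℤ.* + k            ≡⟨ cong (ℤ._* + k) (sym (ℤₚ.pos-+ (2 * P) a)) ⟩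
      + (2 * P + a) ℤ.* + k                  ≡⟨ sym (ℤₚ.pos-* (2 * P + a) k) ⟩
      + S                                    ∎
      where open ≡-Reasoning
    ↧y≡P : ℚᵘ.↧ y ≡ + P
    ↧y≡P = cong (λ t → + suc t) (solve 1 (λ p → (p :+ con 0 :* (con 1 :+ p)) :* con 1 := p) refl p)
      where open +-*-Solver

  mOf-bounds : ∀ ε → 0ℚ ℚ.< ε → Σ[ p ∈ ℕ ] Σ[ E ∈ ℕ ] ∀ k →
    (suc p + suc (suc p)) * k ≤ suc p * mOf ε k × (1 ≤ k → mOf ε k ≤ E * k)
  mOf-bounds (mkℚ (+ zero) _ _)    (ℚ.*<* (ℤ.+<+ ()))
  mOf-bounds (mkℚ -[1+ _ ] _ _)    (ℚ.*<* ())
  mOf-bounds ε@(mkℚ +[1+ a-1 ] p c) _ = p , 3 + a , λ k → lower k , upper k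
    where
    open +-*-Solver
    a = suc a-1
    P = suc p
    S : ℕ → ℕ
    S k = (2 * P + a) * k
    S≤m*P : ∀ k → S k ≤ mOf ε k * P
    S≤m*P k = proj₁ (ceiling-bounds _ (S k) p ([2+a/P]*k≃[2P+a]k/P a-1 p {c} k))
    m*P<S+P : ∀ k → mOf ε k * P < S k + P
    m*P<S+P k = proj₂ (ceiling-bounds _ (S k) p ([2+a/P]*k≃[2P+a]k/P a-1 p {c} k))
    lower : ∀ k → (P + suc P) * k ≤ P * mOf ε k
    lower k = begin
      (P + suc P) * k     ≡⟨ cong (_* k) (solve 1 (λ p → (con 1 :+ p) :+ (con 2 :+ p)
                                                     := con 2 :* (con 1 :+ p) :+ con 1) refl p) ⟩
      (2 * P + 1) * k     ≤⟨ *-monoˡ-≤ k (+-monoʳ-≤ (2 * P) (s≤s z≤n)) ⟩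
      S k                 ≤⟨ S≤m*P k ⟩
      mOf ε k * P         ≡⟨ *-comm (mOf ε k) P ⟩
      P * mOf ε k         ∎
      where open ≤-Reasoning
    upper : ∀ k → 1 ≤ k → mOf ε k ≤ (3 + a) * k
    upper k 1≤k = <⇒≤ (*-cancelʳ-< P (mOf ε k) ((3 + a) * k) (<-≤-trans (m*P<S+P k) (begin
      S k + P                  ≤⟨ +-monoʳ-≤ (S k) (m≤m*n P k) ⟩
      S k + P * k              ≡⟨ solve 3 (λ p a k → (con 2 :* p :+ a) :* k :+ p :* k := (con 3 :* p :+ a) :* k)
                                    refl P a k ⟩
      (3 * P + a) * k          ≤⟨ *-monoˡ-≤ k (+-monoʳ-≤ (3 * P) (m≤n*m a P)) ⟩
      (3 * P + P * a) * k      ≡⟨ solve 3 (λ p a k → (con 3 :* p :+ p :* a) :* k := (con 3 :+ a) :* k :* p) refl P a k ⟩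
      (3 + a) * k * P          ∎)))
      where
      open ≤-Reasoning
      instance
        k-nonZero : ℕ.NonZero k
        k-nonZero = ℕ.>-nonZero 1≤k

open import Defs
open import Data.Nat using (ℕ; suc; _*_; _<_; _≥_)
open import Data.Nat.Combinatorics using (_C_)
open import Data.Rational using (ℚ; 0ℚ) renaming (_<_ to _<ℚ_)
open import Data.List using (List; length)
open import Data.Product using (∃)

open import Data.Nat using (_+_; _^_; _≤_; s≤s; z≤n; >-nonZero)
open import Data.Nat.Properties
open import Data.Product using (_,_; proj₁; proj₂)
open import Relation.Binary.PropositionalEquality
open CoverCount using (cover)
open CubeEncoding
  using (representatives; suc-length-representatives; N≡2*length-representatives; module FamilyBound)
open Estimates
open Ceiling using (mOf-bounds)

family-ratio-bound : ∀ k m q {L} → let n = length (representatives k) in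
  m ≤ n → cover m (suc k) * suc q < 2 ^ m → DisjointFamily (suc k) m L → length L * suc q < N (suc k) C m
family-ratio-bound k m q {L} m≤n cover-small family = begin-strict
  length L * suc q                      ≤⟨ *-monoˡ-≤ (suc q) (FamilyBound.family-bound k m L family) ⟩
  (n C m) * cover m (suc k) * suc q     ≡⟨ *-assoc (n C m) (cover m (suc k)) (suc q) ⟩
  (n C m) * (cover m (suc k) * suc q)   <⟨ *-monoʳ-< (n C m) {{>-nonZero (k≤n⇒0<nCk m≤n)}} cover-small ⟩
  (n C m) * 2 ^ m                       ≤⟨ nCk*2^k≤[n+n]Ck n m ⟩
  (n + n) C m                           ≡⟨ cong (_C m) (sym (N≡2*length-representatives k)) ⟩
  N (suc k) C m                         ∎
  where
  open ≤-Reasoning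
  n = length (representatives k)

theorem3 : (ε : ℚ) → 0ℚ <ℚ ε → (q : ℕ) → ∃ λ K → ∀ k → k ≥ K →
    ∀ (L : List (List (Cube k))) → DisjointFamily k (mOf ε k) L →
    length L * suc q < N k C mOf ε k
theorem3 ε ε>0 q with p , E , m-bounds ← mOf-bounds ε ε>0 = K , bound
  where
  open Exponents p
  K₁ = 4 * E + 4
  K₂ = suc q ^ P * u
  K = suc (K₁ + K₂)
  bound : ∀ k → k ≥ K → ∀ L → DisjointFamily k (mOf ε k) L → length L * suc q < N k C mOf ε k
  bound (suc k) (s≤s K≤k) L = family-ratio-bound k m q m≤n
    (cover-bound q m (suc k) (proj₁ (m-bounds (suc k))) (≤-trans (m≤n+m K₂ K₁) (m≤n⇒m≤1+n K≤k)))
    where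
    m = mOf ε (suc k)
    m≤n : m ≤ length (representatives k)
    m≤n = ≤-pred (begin
      suc m                               ≤⟨ s≤s (proj₂ (m-bounds (suc k)) (s≤s z≤n)) ⟩
      suc (E * suc k)                     ≤⟨ linear<exponential E k (≤-trans (m≤m+n K₁ K₂) K≤k) ⟩
      2 ^ k                               ≡⟨ sym (suc-length-representatives k) ⟩
      suc (length (representatives k))   ∎)
      where open ≤-Reasoning
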